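{- For any prime $p$, any integer $n\geq 1$ and any integer $k\geq 2$, there is a pair of $p$-orthogoval $\mathrm{AG}(k,\mathbb{F}_{p^n})$.
   Context: $\mathrm{AG}(k,K)$ is the $k$-dimensional affine space over the field $K$, and $\mathbb{F}_{p^n}$ is the finite field with $p^n$ elements. For an integer $m$, a pair of spaces, both projective or both affine, of the same dimension and order and defined on the same point set (i.e. two incidence structures on a common point set, each isomorphic to the given space) are called $m$-orthogoval if each line of one space intersects each line of the other space in at most $m$ points. -}

module Defs where

open import Level using (Level; _⊔_; suc)
open import Data.Nat using (ℕ; _^_)
import Data.Nat as ℕ
open import Data.Fin using (Fin)
open import Data.Product using (Σ; ∃; ∃-syntax; _×_; _,_)
open import Relation.Nullary using (¬_)
open import Relation.Binary.PropositionalEquality as ≡ using (_≡_)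
open import Relation.Binary.Bundles using (Setoid)
open import Function.Bundles using (Inverse)
open import Algebra.Bundles using (CommutativeRing)

record IsFieldOfOrder {c ℓ} (F : CommutativeRing c ℓ) (q : ℕ) : Set (c ⊔ ℓ) where
  open CommutativeRing F
  field
    1≉0         : ¬ (1# ≈ 0#)
    invertible  : ∀ x → ¬ (x ≈ 0#) → ∃[ y ] (x * y ≈ 1#)
    enumeration : Inverse (≡.setoid (Fin q)) setoid

-- "A set of elements of a setoid has at most m elements":
-- among any m+1 members, two (with distinct indices) are equal.
AtMost : ∀ {a ℓ r} (S : Setoid a ℓ) → ℕ → (Setoid.Carrier S → Set r) → Set (a ⊔ ℓ ⊔ r)
AtMost S m P = (xs : Fin (ℕ.suc m) → Carrier) → (∀ i → P (xs i)) →
               ∃[ i ] ∃[ j ] (¬ i ≡ j × xs i ≈ xs j)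
  where open Setoid S

module AG {c ℓ} (F : CommutativeRing c ℓ) (k : ℕ) where
  open CommutativeRing F

  Point : Set c
  Point = Fin k → Carrier

  _≈ᵖ_ : Point → Point → Set ℓ
  x ≈ᵖ y = ∀ i → x i ≈ y i

  PointSetoid : Setoid c ℓ
  PointSetoid = record
    { Carrier = Point
    ; _≈_ = _≈ᵖ_
    ; isEquivalence = record
      { refl = λ i → refl
      ; sym = λ e i → sym (e i)
      ; trans = λ e f i → trans (e i) (f i) } }

  record Line : Set (c ⊔ ℓ) where
    field
      base    : Point
      dir     : Point
      dir≢0   : ¬ (∀ i → dir i ≈ 0#)

  _∈ᴸ_ : Point → Line → Set (c ⊔ ℓ)
  x ∈ᴸ L = ∃[ t ] (∀ i → x i ≈ Line.base L i + t * Line.dir L i)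

-- A pair of m-orthogoval AG(k,F): a common point set P carrying two incidence
-- structures, each isomorphic to AG(k,F) via a bijection φᵢ : P → F^k (the lines
-- of the i-th space are the preimages φᵢ⁻¹(L) of the lines L of AG(k,F)), such that
-- every line of the first meets every line of the second in at most m points.
record OrthogovalPair {c ℓ} (F : CommutativeRing c ℓ) (k m : ℕ) : Set (suc (c ⊔ ℓ)) where
  open AG F k
  field
    P  : Setoid c ℓ
    φ₁ : Inverse P PointSetoid
    φ₂ : Inverse P PointSetoid
    orthogoval : ∀ (L₁ L₂ : Line) →
      AtMost P m (λ x → (Inverse.to φ₁ x ∈ᴸ L₁) × (Inverse.to φ₂ x ∈ᴸ L₂))

-- The first copy of AG(k, F) is F^k itself; the second is F^k relabelled by ψ x = x + T x, where
-- T is the Frobenius-semilinear map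
--   T d = (γ d_{k-1}^p + d_0^p, d_0^p, d_1^p, …, d_{k-2}^p).
-- ψ sends the line {a + t d} to the curve t ↦ ψ a + t d + t^p T d. Writing membership in a line
-- with direction e through the 2×2 minors against e gives an equation in t of degree p, or of
-- degree 1, so at most p points are shared, unless d and T d are both multiples of e; then d
-- would be an eigenvector of T. The constant γ is chosen so that T has none: an eigenvector
-- with d_0 ≠ 0 forces γ = h σ with h σ = (σ - 1) u_{k-1}(σ)^p, u_0 = 1, u_{i+1} = σ u_i^p, while
-- h 0 = h 1 = 0 means h misses some value of the finite field F.

module Submission where

open import Level using (_⊔_)
open import Algebra.Bundles using (CommutativeRing)
open import Algebra.Solver.Ring.AlmostCommutativeRing using (fromCommutativeRing; _-Raw-AlmostCommutative⟶_)
import Algebra.Properties.Semiring.Mult as SemiringMultiplication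
open import Data.Empty using (⊥-elim)
open import Data.Fin as Fin using (Fin; zero; suc; toℕ; inject₁; fromℕ; punchOut)
import Data.Fin.Properties as Fin
open import Data.Fin.Induction using (<-weakInduction; >-weakInduction)
import Data.Fin.Permutation as Permutation
open import Data.Integer as ℤ using (ℤ; +_; -[1+_]; _⊖_; sign; ∣_∣; _◃_)
import Data.Integer.Properties as ℤ
open import Data.Maybe using (Maybe; just; nothing)
open import Data.Nat as ℕ using (ℕ; zero; suc; _<_; s≤s; z≤n)
import Data.Nat.Properties as ℕ
open import Data.Nat.Combinatorics using (_C_; nCn≡1; nC1≡n; nCk+nC[k+1]≡[n+1]C[k+1])
open import Data.Nat.Combinatorics.Specification using (k>n⇒nCk≡0)
open import Data.Nat.Divisibility using (_∣_; divides; ∣⇒≤)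
open import Data.Nat.Primality using (Prime; euclidsLemma; prime⇒nonZero)
open import Data.Nat.Tactic.RingSolver using (solve-∀)
open import Data.Product using (∃; ∃-syntax; _×_; _,_; proj₁; proj₂)
open import Data.Sign as Sign using (Sign)
open import Data.Sum using (_⊎_; inj₁; inj₂)
open import Function.Bundles using (Inverse)
import Function.Construct.Identity as Identity
open import Function.Definitions using (Injective; Congruent)
open import Relation.Binary.Bundles using (Setoid)
open import Relation.Binary.Definitions using (Decidable)
open import Relation.Binary.PropositionalEquality as ≡ using (_≡_; _≢_)
open import Relation.Nullary using (¬_; yes; no; ¬?)
open import Relation.Nullary.Decidable using (decidable-stable)
open import Defs

-- The ring solver decides equalities of normal forms by computing on coefficients, which is
-- impossible in an abstract ring; coefficients are therefore integers, mapped canonically into F.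
module IntegerSolver {c ℓ} (F : CommutativeRing c ℓ) where
  open CommutativeRing F
  open import Algebra.Properties.Ring ring using (-1*x≈-x; -‿distribʳ-*)
  open import Algebra.Properties.AbelianGroup +-abelianGroup using (⁻¹-∙-comm)
  open import Algebra.Properties.Group +-group using (⁻¹-involutive; ε⁻¹≈ε)
  open import Algebra.Properties.Semiring.Mult semiring using (×-homo-+; ×1-homo-*) renaming (_×_ to _·_)
  open import Algebra.Properties.CommutativeSemigroup +-commutativeSemigroup using () renaming (interchange to +-interchange)
  open import Algebra.Properties.CommutativeSemigroup *-commutativeSemigroup using () renaming (interchange to *-interchange)
  open import Relation.Binary.Reasoning.Setoid setoid

  ⟦_⟧ℤ : ℤ → Carrier
  ⟦ + n ⟧ℤ      = n · 1#
  ⟦ -[1+ n ] ⟧ℤ = - (suc n · 1#)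

  ⟦⟧-homo-neg : ∀ i → ⟦ ℤ.- i ⟧ℤ ≈ - ⟦ i ⟧ℤ
  ⟦⟧-homo-neg (+ zero)  = sym ε⁻¹≈ε
  ⟦⟧-homo-neg (+ suc n) = refl
  ⟦⟧-homo-neg -[1+ n ]  = sym (⁻¹-involutive _)

  ⟦⟧-homo-⊖ : ∀ m n → ⟦ m ⊖ n ⟧ℤ ≈ m · 1# - n · 1#
  ⟦⟧-homo-⊖ zero    zero    = sym (trans (+-congˡ ε⁻¹≈ε) (+-identityʳ _))
  ⟦⟧-homo-⊖ (suc m) zero    = sym (trans (+-congˡ ε⁻¹≈ε) (+-identityʳ _))
  ⟦⟧-homo-⊖ zero    (suc n) = sym (+-identityˡ _)
  ⟦⟧-homo-⊖ (suc m) (suc n) = begin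
    ⟦ suc m ⊖ suc n ⟧ℤ                  ≡⟨ ≡.cong ⟦_⟧ℤ (ℤ.[1+m]⊖[1+n]≡m⊖n m n) ⟩
    ⟦ m ⊖ n ⟧ℤ                          ≈⟨ ⟦⟧-homo-⊖ m n ⟩
    m · 1# - n · 1#                     ≈⟨ +-congʳ (+-identityˡ _) ⟨
    (0# + m · 1#) - n · 1#              ≈⟨ +-congʳ (+-congʳ (-‿inverseʳ 1#)) ⟨
    ((1# - 1#) + m · 1#) - n · 1#       ≈⟨ +-assoc (1# - 1#) (m · 1#) (- (n · 1#)) ⟩
    (1# - 1#) + (m · 1# - n · 1#)       ≈⟨ +-interchange 1# (- 1#) (m · 1#) (- (n · 1#)) ⟩
    (1# + m · 1#) + (- 1# + - (n · 1#)) ≈⟨ +-congˡ (⁻¹-∙-comm 1# (n · 1#)) ⟩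
    (1# + m · 1#) - (1# + n · 1#)       ∎

  ⟦⟧-homo-+ : ∀ i j → ⟦ i ℤ.+ j ⟧ℤ ≈ ⟦ i ⟧ℤ + ⟦ j ⟧ℤ
  ⟦⟧-homo-+ (+ m)    (+ n)    = ×-homo-+ 1# m n
  ⟦⟧-homo-+ (+ m)    -[1+ n ] = ⟦⟧-homo-⊖ m (suc n)
  ⟦⟧-homo-+ -[1+ m ] (+ n)    = trans (⟦⟧-homo-⊖ n (suc m)) (+-comm _ _)
  ⟦⟧-homo-+ -[1+ m ] -[1+ n ] = begin
    - (suc (suc (m ℕ.+ n)) · 1#)   ≡⟨ ≡.cong (λ k → - (suc k · 1#)) (ℕ.+-suc m n) ⟨
    - ((suc m ℕ.+ suc n) · 1#)     ≈⟨ -‿cong (×-homo-+ 1# (suc m) (suc n)) ⟩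
    - (suc m · 1# + suc n · 1#)    ≈⟨ ⁻¹-∙-comm _ _ ⟨
    - (suc m · 1#) + - (suc n · 1#) ∎

  ⟦_⟧ₛ : Sign → Carrier
  ⟦ Sign.+ ⟧ₛ = 1#
  ⟦ Sign.- ⟧ₛ = - 1#

  ⟦⟧ₛ-homo-* : ∀ s t → ⟦ s Sign.* t ⟧ₛ ≈ ⟦ s ⟧ₛ * ⟦ t ⟧ₛ
  ⟦⟧ₛ-homo-* Sign.+ t      = sym (*-identityˡ _)
  ⟦⟧ₛ-homo-* Sign.- Sign.+ = sym (*-identityʳ _)
  ⟦⟧ₛ-homo-* Sign.- Sign.- = begin
    1#            ≈⟨ ⁻¹-involutive 1# ⟨
    - - 1#        ≈⟨ -‿cong (-1*x≈-x 1#) ⟨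
    - (- 1# * 1#) ≈⟨ -‿distribʳ-* (- 1#) 1# ⟩
    - 1# * - 1#   ∎

  ⟦◃⟧ : ∀ s n → ⟦ s ◃ n ⟧ℤ ≈ ⟦ s ⟧ₛ * (n · 1#)
  ⟦◃⟧ Sign.+ zero    = sym (*-identityˡ _)
  ⟦◃⟧ Sign.+ (suc n) = sym (*-identityˡ _)
  ⟦◃⟧ Sign.- zero    = sym (zeroʳ _)
  ⟦◃⟧ Sign.- (suc n) = sym (-1*x≈-x _)

  ⟦⟧-sign-abs : ∀ i → ⟦ i ⟧ℤ ≈ ⟦ sign i ⟧ₛ * (∣ i ∣ · 1#)
  ⟦⟧-sign-abs i = trans (reflexive (≡.cong ⟦_⟧ℤ (≡.sym (ℤ.◃-inverse i)))) (⟦◃⟧ (sign i) ∣ i ∣)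

  ⟦⟧-homo-* : ∀ i j → ⟦ i ℤ.* j ⟧ℤ ≈ ⟦ i ⟧ℤ * ⟦ j ⟧ℤ
  ⟦⟧-homo-* i j = begin
    ⟦ i ℤ.* j ⟧ℤ
      ≈⟨ ⟦◃⟧ (sign i Sign.* sign j) (∣ i ∣ ℕ.* ∣ j ∣) ⟩
    ⟦ sign i Sign.* sign j ⟧ₛ * ((∣ i ∣ ℕ.* ∣ j ∣) · 1#)
      ≈⟨ *-cong (⟦⟧ₛ-homo-* (sign i) (sign j)) (×1-homo-* ∣ i ∣ ∣ j ∣) ⟩
    (s * t) * (x * y)
      ≈⟨ *-interchange s t x y ⟩
    (s * x) * (t * y)
      ≈⟨ *-cong (⟦⟧-sign-abs i) (⟦⟧-sign-abs j) ⟨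
    ⟦ i ⟧ℤ * ⟦ j ⟧ℤ
      ∎
    where
    s = ⟦ sign i ⟧ₛ
    t = ⟦ sign j ⟧ₛ
    x = ∣ i ∣ · 1#
    y = ∣ j ∣ · 1#

  ℤ⟶F : ℤ.+-*-rawRing -Raw-AlmostCommutative⟶ fromCommutativeRing F
  ℤ⟶F = record
    { ⟦_⟧    = ⟦_⟧ℤ
    ; +-homo = ⟦⟧-homo-+
    ; *-homo = ⟦⟧-homo-*
    ; -‿homo = ⟦⟧-homo-neg
    ; 0-homo = refl
    ; 1-homo = +-identityʳ 1#
    }

  coefficient-≟ : ∀ i j → Maybe (⟦ i ⟧ℤ ≈ ⟦ j ⟧ℤ)
  coefficient-≟ i j with i ℤ.≟ j
  ... | yes i≡j = just (reflexive (≡.cong ⟦_⟧ℤ i≡j))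
  ... | no _    = nothing

  open import Algebra.Solver.Ring ℤ.+-*-rawRing (fromCommutativeRing F) ℤ⟶F coefficient-≟ public

Fin-injective⇒surjective : ∀ {N} (g : Fin N → Fin N) → Injective _≡_ _≡_ g → ∀ y → ∃[ x ] g x ≡ y
Fin-injective⇒surjective {ℕ.suc N} g g-inj y with Fin.any? (λ x → g x Fin.≟ y)
... | yes found  = found
... | no missing = ⊥-elim (ℕ.<-irrefl ≡.refl (Fin.injective⇒≤ punchOut-g-injective))
  where
  y≢g : ∀ x → y ≢ g x
  y≢g x y≡gx = missing (x , ≡.sym y≡gx)
  punchOut-g-injective : Injective _≡_ _≡_ (λ x → punchOut (y≢g x))
  punchOut-g-injective eq = g-inj (Fin.punchOut-injective (y≢g _) (y≢g _) eq)

module FiniteSetoid {a ℓ} (S : Setoid a ℓ) {N : ℕ} (enum : Inverse (≡.setoid (Fin N)) S) where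
  open Setoid S
  open Inverse enum using (to; from; from-cong; strictlyInverseˡ; strictlyInverseʳ)
  open import Relation.Binary.Reasoning.Setoid S

  from-injective : Injective _≈_ _≡_ from
  from-injective {x} {y} eq = begin
    x             ≈⟨ strictlyInverseˡ x ⟨
    to (from x)   ≡⟨ ≡.cong to eq ⟩
    to (from y)   ≈⟨ strictlyInverseˡ y ⟩
    y             ∎

  _≟_ : Decidable _≈_
  x ≟ y with from x Fin.≟ from y
  ... | yes eq = yes (from-injective eq)
  ... | no ne  = no (λ x≈y → ne (from-cong x≈y))

  injective⇒surjective : ∀ f → Injective _≈_ _≈_ f → ∀ y → ∃[ x ] f x ≈ y
  injective⇒surjective f f-inj y =
    let i , eq = Fin-injective⇒surjective (λ i → from (f (to i))) G-inj (from y)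
    in to i , from-injective eq
    where
    G-inj : Injective _≡_ _≡_ (λ i → from (f (to i)))
    G-inj {i} {j} eq = ≡.trans (≡.sym (strictlyInverseʳ i))
      (≡.trans (from-cong (f-inj (from-injective eq))) (strictlyInverseʳ j))

  module _ (f : Carrier → Carrier) (f-cong : Congruent _≈_ _≈_ f) (f-inj : Injective _≈_ _≈_ f) where

    private
      f⁻¹ : Carrier → Carrier
      f⁻¹ y = proj₁ (injective⇒surjective f f-inj y)

      f∘f⁻¹ : ∀ y → f (f⁻¹ y) ≈ y
      f∘f⁻¹ y = proj₂ (injective⇒surjective f f-inj y)

    injective⇒inverse : Inverse S S
    injective⇒inverse = record
      { to        = f
      ; from      = f⁻¹
      ; to-cong   = f-cong
      ; from-cong = f⁻¹-cong
      ; inverse   = (λ {x} y≈f⁻¹x → trans (f-cong y≈f⁻¹x) (f∘f⁻¹ x))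
                  , (λ {x} {y} y≈fx → f-inj (trans (f∘f⁻¹ y) y≈fx))
      }
      where
      f⁻¹-cong : Congruent _≈_ _≈_ f⁻¹
      f⁻¹-cong x≈y = f-inj (trans (f∘f⁻¹ _) (trans x≈y (sym (f∘f⁻¹ _))))

  surjective⇒injective : ∀ f → Congruent _≈_ _≈_ f → (∀ y → ∃[ x ] f x ≈ y) → Injective _≈_ _≈_ f
  surjective⇒injective f f-cong f-surj {x} {y} fx≈fy =
    let x′ , sx′≈x = injective⇒surjective s s-inj x
        y′ , sy′≈y = injective⇒surjective s s-inj y
    in trans (sym sx′≈x) (trans (s-cong (preimages-equal sx′≈x sy′≈y)) sy′≈y)
    where
    -- Choosing preimages through the enumeration makes the section congruent.
    s : Carrier → Carrier
    s y = proj₁ (f-surj (to (from y)))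
    s-cong : Congruent _≈_ _≈_ s
    s-cong x≈y = reflexive (≡.cong (λ i → proj₁ (f-surj (to i))) (from-cong x≈y))
    s-section : ∀ y → f (s y) ≈ y
    s-section y = trans (proj₂ (f-surj (to (from y)))) (strictlyInverseˡ y)
    s-inj : Injective _≈_ _≈_ s
    s-inj {y₁} {y₂} eq = trans (sym (s-section y₁)) (trans (f-cong eq) (s-section y₂))
    preimages-equal : ∀ {x′ y′} → s x′ ≈ x → s y′ ≈ y → x′ ≈ y′
    preimages-equal {x′} {y′} sx′≈x sy′≈y = begin
      x′        ≈⟨ s-section x′ ⟨
      f (s x′)  ≈⟨ f-cong sx′≈x ⟩
      f x       ≈⟨ fx≈fy ⟩
      f y       ≈⟨ f-cong sy′≈y ⟨
      f (s y′)  ≈⟨ s-section y′ ⟩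
      y′        ∎

  nonInjective⇒missesValue : ∀ f → Congruent _≈_ _≈_ f → ∀ {u v} → ¬ u ≈ v → f u ≈ f v →
                             ∃[ c ] ∀ x → ¬ f x ≈ c
  nonInjective⇒missesValue f f-cong u≉v fu≈fv
    with Fin.all? (λ i → Fin.any? (λ j → f (to j) ≟ to i))
  ... | yes hits-all = ⊥-elim (u≉v (surjective⇒injective f f-cong f-surj fu≈fv))
    where
    f-surj : ∀ y → ∃[ x ] f x ≈ y
    f-surj y = let j , fj≈y = hits-all (from y) in to j , trans fj≈y (strictlyInverseˡ y)
  ... | no ¬hits-all =
    let i , misses = Fin.¬∀⟶∃¬ N _ (λ i → Fin.any? (λ j → f (to j) ≟ to i)) ¬hits-all
    in to i , λ x fx≈c → misses (from x , trans (f-cong (strictlyInverseˡ x)) fx≈c)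

module FiniteField {c ℓ} (F : CommutativeRing c ℓ) {q : ℕ} (F-field : IsFieldOfOrder F q) where
  open CommutativeRing F hiding (zero)
  open IsFieldOfOrder F-field
  open FiniteSetoid setoid enumeration public using (_≟_; nonInjective⇒missesValue)
  open Inverse enumeration using (to; from; from-cong; strictlyInverseˡ; strictlyInverseʳ)
  open IntegerSolver F using (solve; _:+_; _:*_; _:-_; _:=_)
  open import Algebra.Properties.Semiring.Exp semiring public using (_^_; ^-congˡ)
  open import Algebra.Properties.Semiring.Mult semiring public using (×1-homo-*) renaming (_×_ to _·_)
  open import Algebra.Properties.Group +-group public
    using () renaming (x∙y⁻¹≈ε⇒x≈y to x-y≈0⇒x≈y; x≈y⇒x∙y⁻¹≈ε to x≈y⇒x-y≈0; inverseʳ-unique to x+y≈0⇒y≈-x)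
  open import Relation.Binary.Reasoning.Setoid setoid

  inverse : ∀ x → ¬ x ≈ 0# → Carrier
  inverse x x≉0 = proj₁ (invertible x x≉0)

  *-inverseʳ : ∀ x (x≉0 : ¬ x ≈ 0#) → x * inverse x x≉0 ≈ 1#
  *-inverseʳ x x≉0 = proj₂ (invertible x x≉0)

  *-cancelˡ : ∀ {x a b} → ¬ x ≈ 0# → x * a ≈ x * b → a ≈ b
  *-cancelˡ {x} {a} {b} x≉0 xa≈xb = begin
    a                 ≈⟨ *-identityˡ a ⟨
    1# * a            ≈⟨ *-congʳ x⁻¹x≈1 ⟨
    (x⁻¹ * x) * a     ≈⟨ *-assoc x⁻¹ x a ⟩
    x⁻¹ * (x * a)     ≈⟨ *-congˡ xa≈xb ⟩
    x⁻¹ * (x * b)     ≈⟨ *-assoc x⁻¹ x b ⟨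
    (x⁻¹ * x) * b     ≈⟨ *-congʳ x⁻¹x≈1 ⟩
    1# * b            ≈⟨ *-identityˡ b ⟩
    b                 ∎
    where
    x⁻¹ = inverse x x≉0
    x⁻¹x≈1 = trans (*-comm x⁻¹ x) (*-inverseʳ x x≉0)

  x*y≈0⇒y≈0 : ∀ {x y} → ¬ x ≈ 0# → x * y ≈ 0# → y ≈ 0#
  x*y≈0⇒y≈0 {x} x≉0 xy≈0 = *-cancelˡ x≉0 (trans xy≈0 (sym (zeroʳ x)))

  x^n≈0⇒x≈0 : ∀ n {x} → x ^ n ≈ 0# → x ≈ 0#
  x^n≈0⇒x≈0 zero    1≈0 = ⊥-elim (1≉0 1≈0)
  x^n≈0⇒x≈0 (suc n) {x} x^[1+n]≈0 with x ≟ 0#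
  ... | yes x≈0 = x≈0
  ... | no  x≉0 = x^n≈0⇒x≈0 n (x*y≈0⇒y≈0 x≉0 x^[1+n]≈0)

  -- Translation by x permutes the q elements of F, so summing y ↦ y + x over F
  -- gives the sum of F plus q · x.
  q·x≈0 : ∀ x → q · x ≈ 0#
  q·x≈0 x = begin
    q · x                               ≈⟨ solve 2 (λ s y → y := (s :+ y) :- s) refl S (q · x) ⟩
    (S + q · x) - S                     ≈⟨ +-congʳ (+-congˡ (sum-replicate q)) ⟨
    (S + sum (replicate q x)) - S       ≈⟨ +-congʳ (∑-distrib-+ to (λ _ → x)) ⟨
    sum (λ i → to i + x) - S            ≈⟨ +-congʳ (sum-cong-≋ (λ i → sym (strictlyInverseˡ (to i + x)))) ⟩
    sum (λ i → to (Permutation._⟨$⟩ʳ_ π i)) - S ≈⟨ +-congʳ (sum-permute to π) ⟨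
    S - S                               ≈⟨ -‿inverseʳ S ⟩
    0#                                  ∎
    where
    open import Algebra.Properties.CommutativeMonoid.Sum +-commutativeMonoid
    open import Data.Vec.Functional using (replicate)
    S = sum to
    shift : Carrier → Fin q → Fin q
    shift a i = from (to i + a)
    shift-shift : ∀ {a b} → a + b ≈ 0# → ∀ i → shift b (shift a i) ≡ i
    shift-shift {a} {b} a+b≈0 i = ≡.trans (from-cong (begin
      to (shift a i) + b   ≈⟨ +-congʳ (strictlyInverseˡ _) ⟩
      (to i + a) + b       ≈⟨ +-assoc (to i) a b ⟩
      to i + (a + b)       ≈⟨ +-congˡ a+b≈0 ⟩
      to i + 0#            ≈⟨ +-identityʳ (to i) ⟩
      to i                 ∎)) (strictlyInverseʳ i)
    π : Permutation.Permutation q q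
    π = Permutation.permutation (shift x) (shift (- x))
          (shift-shift (-‿inverseˡ x)) (shift-shift (-‿inverseʳ x))

  data IsMonic : ℕ → (Carrier → Carrier) → Set (c ⊔ ℓ) where
    constant : ∀ {f} → (∀ x → f x ≈ 1#) → IsMonic 0 f
    horner   : ∀ {m f g} a → IsMonic m g → (∀ x → f x ≈ a + x * g x) → IsMonic (suc m) f

  x^m-monic : ∀ m → IsMonic m (_^ m)
  x^m-monic zero    = constant (λ _ → refl)
  x^m-monic (suc m) = horner 0# (x^m-monic m) (λ _ → sym (+-identityˡ _))

  monic-+-lower : ∀ {m g h} → IsMonic (suc m) g → IsMonic m h → ∀ r → IsMonic (suc m) (λ x → g x + r * h x)
  monic-+-lower {zero} {g} {h} (horner {g = g′} a g′-monic g≈) (constant h≈1) r =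
    horner (a + r) g′-monic λ x → begin
      g x + r * h x              ≈⟨ +-cong (g≈ x) (*-congˡ (h≈1 x)) ⟩
      (a + x * g′ x) + r * 1#    ≈⟨ +-congˡ (*-identityʳ r) ⟩
      (a + x * g′ x) + r         ≈⟨ solve 3 (λ a y r → (a :+ y) :+ r := (a :+ r) :+ y) refl a (x * g′ x) r ⟩
      (a + r) + x * g′ x         ∎
  monic-+-lower {suc m} {g} {h} (horner {g = g′} a g′-monic g≈) (horner {g = h′} b h′-monic h≈) r =
    horner (a + r * b) (monic-+-lower g′-monic h′-monic r) λ x → begin
      g x + r * h x                           ≈⟨ +-cong (g≈ x) (*-congˡ (h≈ x)) ⟩
      (a + x * g′ x) + r * (b + x * h′ x)
        ≈⟨ solve 6 (λ a x u r b v → (a :+ x :* u) :+ r :* (b :+ x :* v) := (a :+ r :* b) :+ x :* (u :+ r :* v))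
             refl a x (g′ x) r b (h′ x) ⟩
      (a + r * b) + x * (g′ x + r * h′ x)     ∎

  monic-factor : ∀ {m f} → IsMonic (suc m) f → ∀ r →
                 ∃[ g ] IsMonic m g × (∀ x → f x ≈ f r + (x - r) * g x)
  monic-factor {zero} {f} (horner {g = g} a (constant g≈1) f≈) r = (λ _ → 1#) , constant (λ _ → refl) , λ x → begin
    f x                         ≈⟨ f≈ x ⟩
    a + x * g x                 ≈⟨ +-congˡ (trans (*-congˡ (g≈1 x)) (*-identityʳ x)) ⟩
    a + x                       ≈⟨ solve 3 (λ a x r → a :+ x := (a :+ r) :+ (x :- r)) refl a x r ⟩
    (a + r) + (x - r)           ≈⟨ +-cong (+-congˡ (sym (trans (*-congˡ (g≈1 r)) (*-identityʳ r)))) (sym (*-identityʳ _)) ⟩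
    (a + r * g r) + (x - r) * 1# ≈⟨ +-congʳ (f≈ r) ⟨
    f r + (x - r) * 1#          ∎
  monic-factor {suc m} {f} (horner {g = g} a g-monic f≈) r =
    let h , h-monic , g≈ = monic-factor g-monic r
    in (λ x → g x + r * h x) , monic-+-lower g-monic h-monic r , λ x → begin
      f x                                                 ≈⟨ f≈ x ⟩
      a + x * g x                                         ≈⟨ +-congˡ (*-congˡ (g≈ x)) ⟩
      a + x * (g r + (x - r) * h x)
        ≈⟨ solve 5 (λ a x r u v → a :+ x :* (u :+ (x :- r) :* v)
                                 := (a :+ r :* u) :+ (x :- r) :* ((u :+ (x :- r) :* v) :+ r :* v))
             refl a x r (g r) (h x) ⟩
      (a + r * g r) + (x - r) * ((g r + (x - r) * h x) + r * h x)
        ≈⟨ +-cong (sym (f≈ r)) (*-congˡ (+-congʳ (sym (g≈ x)))) ⟩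
      f r + (x - r) * (g x + r * h x)                     ∎

  monic-roots-atMost : ∀ {m f} → IsMonic m f → AtMost setoid m (λ x → f x ≈ 0#)
  monic-roots-atMost (constant f≈1) xs roots = ⊥-elim (1≉0 (trans (sym (f≈1 (xs zero))) (roots zero)))
  monic-roots-atMost {suc m} {f} f-monic xs roots with Fin.any? (λ i → xs (suc i) ≟ xs zero)
  ... | yes (i , xᵢ≈x₀) = suc i , zero , (λ ()) , xᵢ≈x₀
  ... | no  x₀-new =
    let g , g-monic , f≈ = monic-factor f-monic (xs zero)
        i , j , i≢j , xᵢ≈xⱼ = monic-roots-atMost g-monic (λ i → xs (suc i)) (quotient-root {g} f≈)
    in suc i , suc j , (λ eq → i≢j (Fin.suc-injective eq)) , xᵢ≈xⱼ
    where
    quotient-root : ∀ {g} → (∀ x → f x ≈ f (xs zero) + (x - xs zero) * g x) → ∀ i → g (xs (suc i)) ≈ 0#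
    quotient-root {g} f≈ i = x*y≈0⇒y≈0 (λ d≈0 → x₀-new (i , x-y≈0⇒x≈y _ _ d≈0)) (begin
      (x - x₀) * g x        ≈⟨ +-identityˡ _ ⟨
      0# + (x - x₀) * g x   ≈⟨ +-congʳ (roots zero) ⟨
      f x₀ + (x - x₀) * g x ≈⟨ f≈ x ⟨
      f x                   ≈⟨ roots (suc i) ⟩
      0#                    ∎)
      where
      x = xs (suc i)
      x₀ = xs zero

  x^[2+r]+αx+β-monic : ∀ r α β → IsMonic (suc (suc r)) (λ t → t ^ suc (suc r) + α * t + β)
  x^[2+r]+αx+β-monic r α β =
    horner β (horner α (x^m-monic r) (λ _ → refl)) λ t →
      solve 4 (λ t u α β → t :* (t :* u) :+ α :* t :+ β := β :+ t :* (α :+ t :* u)) refl t (t ^ r) α β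

  q≡p^n⇒p·1≈0 : ∀ {p} n → q ≡ p ℕ.^ n → p · 1# ≈ 0#
  q≡p^n⇒p·1≈0 {p} n q≡p^n =
    x^n≈0⇒x≈0 n (trans (sym (·1-homo-^ n)) (≡.subst (λ r → r · 1# ≈ 0#) q≡p^n (q·x≈0 1#)))
    where
    ·1-homo-^ : ∀ n → (p ℕ.^ n) · 1# ≈ (p · 1#) ^ n
    ·1-homo-^ zero    = +-identityʳ 1#
    ·1-homo-^ (suc n) = trans (×1-homo-* p (p ℕ.^ n)) (*-congˡ (·1-homo-^ n))

[1+k]*[1+n]C[1+k] : ∀ n k → suc k ℕ.* (suc n C suc k) ≡ suc n ℕ.* (n C k)
[1+k]*[1+n]C[1+k] zero zero = ≡.refl
[1+k]*[1+n]C[1+k] zero (suc k) = begin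
  suc (suc k) ℕ.* (1 C suc (suc k)) ≡⟨ ≡.cong (suc (suc k) ℕ.*_) (k>n⇒nCk≡0 {1} {suc (suc k)} (s≤s (s≤s z≤n))) ⟩
  suc (suc k) ℕ.* 0                 ≡⟨ ℕ.*-zeroʳ (suc (suc k)) ⟩
  0                                 ≡⟨ ≡.cong (1 ℕ.*_) (k>n⇒nCk≡0 {0} {suc k} (s≤s z≤n)) ⟨
  1 ℕ.* (0 C suc k)                 ∎
  where open ≡.≡-Reasoning
[1+k]*[1+n]C[1+k] (suc n) zero = ≡.trans (ℕ.+-identityʳ _) (≡.trans (nC1≡n (suc (suc n))) (≡.sym (ℕ.*-identityʳ _)))
[1+k]*[1+n]C[1+k] (suc n) (suc k) = begin
  suc (suc k) ℕ.* (suc (suc n) C suc (suc k)) ≡⟨ ≡.cong (suc (suc k) ℕ.*_) (nCk+nC[k+1]≡[n+1]C[k+1] (suc n) (suc k)) ⟨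
  suc (suc k) ℕ.* (A ℕ.+ B)                   ≡⟨ regroup₁ k A B ⟩
  (suc k ℕ.* A ℕ.+ A) ℕ.+ suc (suc k) ℕ.* B   ≡⟨ ≡.cong₂ (λ u v → (u ℕ.+ A) ℕ.+ v)
                                                   ([1+k]*[1+n]C[1+k] n k) ([1+k]*[1+n]C[1+k] n (suc k)) ⟩
  (suc n ℕ.* (n C k) ℕ.+ A) ℕ.+ suc n ℕ.* (n C suc k) ≡⟨ regroup₂ n (n C k) (n C suc k) A ⟩
  suc n ℕ.* (n C k ℕ.+ n C suc k) ℕ.+ A       ≡⟨ ≡.cong (λ u → suc n ℕ.* u ℕ.+ A) (nCk+nC[k+1]≡[n+1]C[k+1] n k) ⟩
  suc n ℕ.* A ℕ.+ A                           ≡⟨ ℕ.+-comm (suc n ℕ.* A) A ⟩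
  suc (suc n) ℕ.* A                           ∎
  where
  open ≡.≡-Reasoning
  A = suc n C suc k
  B = suc n C suc (suc k)
  regroup₁ : ∀ k a b → suc (suc k) ℕ.* (a ℕ.+ b) ≡ (suc k ℕ.* a ℕ.+ a) ℕ.+ suc (suc k) ℕ.* b
  regroup₁ = solve-∀
  regroup₂ : ∀ n x y a → (suc n ℕ.* x ℕ.+ a) ℕ.+ suc n ℕ.* y ≡ suc n ℕ.* (x ℕ.+ y) ℕ.+ a
  regroup₂ = solve-∀

p∣pCk : ∀ {p k} → Prime p → 0 < k → k < p → p ∣ p C k
p∣pCk {suc n} {suc k} p-prime _ k<p
  with euclidsLemma (suc k) (suc n C suc k) p-prime
         (divides (n C k) (≡.trans ([1+k]*[1+n]C[1+k] n k) (ℕ.*-comm (suc n) (n C k))))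
... | inj₁ p∣1+k = ⊥-elim (ℕ.<-irrefl ≡.refl (ℕ.<-≤-trans k<p (∣⇒≤ p∣1+k)))
... | inj₂ p∣pCk = p∣pCk

module Frobenius {c ℓ} (F : CommutativeRing c ℓ) {p} (p-prime : Prime p) where
  open CommutativeRing F hiding (zero)
  open SemiringMultiplication semiring using (×-assoc-*) renaming (_×_ to _·_)

  open import Algebra.Properties.CommutativeSemiring.Binomial commutativeSemiring
  open import Algebra.Properties.Semiring.Exp semiring using (_^_)
  open import Algebra.Properties.Monoid.Mult +-monoid using (×-assocˡ; ×-congʳ)
  open import Algebra.Properties.Monoid.Sum +-monoid using (sum; sum-init-last; sum-cong-≋; sum-replicate; sum-replicate-zero)
  open import Relation.Binary.Reasoning.Setoid setoid

  module _ (p·1≈0 : p · 1# ≈ 0#) where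
    multiple-of-p·≈0 : ∀ {m} → p ∣ m → ∀ z → m · z ≈ 0#
    multiple-of-p·≈0 {m} (divides k ≡.refl) z = begin
      (k ℕ.* p) · z   ≈⟨ ×-assocˡ z k p ⟨
      k · (p · z)     ≈⟨ ×-congʳ k p·z≈0 ⟩
      k · 0#          ≈⟨ ·0≈0 k ⟩
      0#              ∎
      where
      p·z≈0 : p · z ≈ 0#
      p·z≈0 = begin
        p · z          ≈⟨ ×-congʳ p (*-identityˡ z) ⟨
        p · (1# * z)   ≈⟨ ×-assoc-* p 1# z ⟨
        (p · 1#) * z   ≈⟨ *-congʳ p·1≈0 ⟩
        0# * z         ≈⟨ zeroˡ z ⟩
        0#             ∎
      ·0≈0 : ∀ k → k · 0# ≈ 0#
      ·0≈0 k = trans (sym (sum-replicate k)) (sum-replicate-zero k)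

    frobenius-+ : ∀ x y → (x + y) ^ p ≈ x ^ p + y ^ p
    frobenius-+ x y = begin
      (x + y) ^ p                    ≈⟨ theorem p x y ⟩
      binomialExpansion x y p        ≡⟨ ≡.cong (binomialExpansion x y) p≡1+m ⟨
      binomialExpansion x y (suc m)  ≈⟨ +-congˡ (sum-init-last (λ i → t (suc i))) ⟩
      t zero + (sum (λ i → t (suc (inject₁ i))) + t (suc (fromℕ m)))
                                     ≈⟨ +-cong first (+-cong (trans (sum-cong-≋ middle) (sum-replicate-zero m)) last) ⟩
      y ^ suc m + (0# + x ^ suc m)   ≈⟨ trans (+-congˡ (+-identityˡ _)) (+-comm _ _) ⟩
      x ^ suc m + y ^ suc m          ≡⟨ ≡.cong (λ r → x ^ r + y ^ r) p≡1+m ⟩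
      x ^ p + y ^ p                  ∎
      where
      instance _ = prime⇒nonZero p-prime
      m = ℕ.pred p
      p≡1+m : suc m ≡ p
      p≡1+m = ℕ.suc-pred p
      t = binomialTerm x y (suc m)
      first : t zero ≈ y ^ suc m
      first = trans (+-identityʳ _) (*-identityˡ _)
      last : t (suc (fromℕ m)) ≈ x ^ suc m
      last = begin
        (suc m C suc (toℕ (fromℕ m))) · (x ^ suc (toℕ (fromℕ m)) * y ^ (m ℕ.∸ toℕ (fromℕ m)))
          ≡⟨ ≡.cong (λ r → (suc m C suc r) · (x ^ suc r * y ^ (m ℕ.∸ r))) (Fin.toℕ-fromℕ m) ⟩
        (suc m C suc m) · (x ^ suc m * y ^ (m ℕ.∸ m))
          ≡⟨ ≡.cong₂ (λ c r → c · (x ^ suc m * y ^ r)) (nCn≡1 (suc m)) (ℕ.n∸n≡0 m) ⟩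
        1 · (x ^ suc m * 1#)  ≈⟨ +-identityʳ _ ⟩
        x ^ suc m * 1#        ≈⟨ *-identityʳ _ ⟩
        x ^ suc m             ∎
      middle : ∀ (i : Fin m) → t (suc (inject₁ i)) ≈ 0#
      middle i = multiple-of-p·≈0 (≡.subst (λ r → p ∣ r C suc (toℕ (inject₁ i))) (≡.sym p≡1+m)
                   (p∣pCk p-prime (s≤s z≤n) (≡.subst (suc (toℕ (inject₁ i)) <_) p≡1+m (s≤s (Fin.inject₁ℕ< i))))) _

funToFin-cong : ∀ {k N} {f g : Fin k → Fin N} → (∀ m → f m ≡ g m) → Fin.funToFin f ≡ Fin.funToFin g
funToFin-cong {ℕ.zero}  f≗g = ≡.refl
funToFin-cong {ℕ.suc k} f≗g = ≡.cong₂ Fin.combine (f≗g zero) (funToFin-cong (λ m → f≗g (suc m)))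

module AffineSpace {c ℓ} (F : CommutativeRing c ℓ) {q : ℕ} (F-field : IsFieldOfOrder F q) (k : ℕ) where
  open CommutativeRing F hiding (zero)
  open IsFieldOfOrder F-field
  open FiniteField F F-field
  open AG F k public
  open IntegerSolver F using (solve; _:+_; _:*_; _:-_; _:=_)
  open import Algebra.Properties.AbelianGroup +-abelianGroup using () renaming (xyx⁻¹≈y to x+y-x≈y)
  open import Relation.Binary.Reasoning.Setoid setoid

  Point-enumeration : Inverse (≡.setoid (Fin (q ℕ.^ k))) PointSetoid
  Point-enumeration = record
    { to        = λ i m → to (Fin.finToFun i m)
    ; from      = λ x → Fin.funToFin (λ m → from (x m))
    ; to-cong   = λ { ≡.refl m → refl }
    ; from-cong = λ x≈y → funToFin-cong (λ m → from-cong (x≈y m))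
    ; inverse   = (λ { {x} ≡.refl m → trans (reflexive (≡.cong to (Fin.finToFun-funToFin _ m))) (strictlyInverseˡ (x m)) })
                , (λ {i} y≈ → ≡.trans (funToFin-cong (λ m → ≡.trans (from-cong (y≈ m)) (strictlyInverseʳ _)))
                                      (Fin.funToFin-finToFin {k} {q} i))
    }
    where open Inverse enumeration

  zero-or-nonzero-coordinate : ∀ (x : Point) → (∀ m → x m ≈ 0#) ⊎ ∃[ j ] ¬ x j ≈ 0#
  zero-or-nonzero-coordinate x with Fin.any? (λ j → ¬? (x j ≟ 0#))
  ... | yes found = inj₂ found
  ... | no  none  = inj₁ (λ j → decidable-stable (x j ≟ 0#) (λ xⱼ≉0 → none (j , xⱼ≉0)))

  infix 4 _∥_
  _∥_ : Point → Point → Set (c ⊔ ℓ)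
  x ∥ e = ∃[ s ] ∀ m → x m ≈ s * e m

  ∈ᴸ-resp-≈ᵖ : ∀ {x y} (L : Line) → x ≈ᵖ y → x ∈ᴸ L → y ∈ᴸ L
  ∈ᴸ-resp-≈ᵖ L x≈y (t , on-L) = t , λ m → trans (sym (x≈y m)) (on-L m)

  ∥-through : ∀ {x y e} → y ∥ e → x ∥ e → ¬ (∀ m → x m ≈ 0#) → y ∥ x
  ∥-through {x} {y} {e} (μ , y≈μe) (λ′ , x≈λe) x≉0 = μ * λ⁻¹ , λ m → begin
    y m                      ≈⟨ y≈μe m ⟩
    μ * e m                  ≈⟨ *-congʳ (*-identityʳ μ) ⟨
    (μ * 1#) * e m           ≈⟨ *-congʳ (*-congˡ (trans (*-comm λ⁻¹ λ′) (*-inverseʳ λ′ λ≉0))) ⟨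
    (μ * (λ⁻¹ * λ′)) * e m   ≈⟨ solve 4 (λ a b c d → (a :* (b :* c)) :* d := (a :* b) :* (c :* d)) refl μ λ⁻¹ λ′ (e m) ⟩
    (μ * λ⁻¹) * (λ′ * e m)   ≈⟨ *-congˡ (x≈λe m) ⟨
    (μ * λ⁻¹) * x m          ∎
    where
    λ≉0 : ¬ λ′ ≈ 0#
    λ≉0 λ≈0 = x≉0 λ m → trans (x≈λe m) (trans (*-congʳ λ≈0) (zeroˡ (e m)))
    λ⁻¹ = inverse λ′ λ≉0

  minor : Fin k → Point → Point → Point
  minor j x e m = x m * e j - x j * e m

  minors-vanish⇒∥ : ∀ {x e j} → ¬ e j ≈ 0# → (∀ m → minor j x e m ≈ 0#) → x ∥ e
  minors-vanish⇒∥ {x} {e} {j} eⱼ≉0 minors≈0 = x j * eⱼ⁻¹ , λ m → begin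
    x m                      ≈⟨ *-identityʳ (x m) ⟨
    x m * 1#                 ≈⟨ *-congˡ (*-inverseʳ (e j) eⱼ≉0) ⟨
    x m * (e j * eⱼ⁻¹)       ≈⟨ *-assoc (x m) (e j) eⱼ⁻¹ ⟨
    (x m * e j) * eⱼ⁻¹       ≈⟨ *-congʳ (x-y≈0⇒x≈y _ _ (minors≈0 m)) ⟩
    (x j * e m) * eⱼ⁻¹       ≈⟨ solve 3 (λ a b c → (a :* b) :* c := (a :* c) :* b) refl (x j) (e m) eⱼ⁻¹ ⟩
    (x j * eⱼ⁻¹) * e m       ∎
    where eⱼ⁻¹ = inverse (e j) eⱼ≉0

  Curve : ℕ → Point → Point → Point → Carrier → Point
  Curve r a d v t m = a m + (t * d m + t ^ r * v m)

  curve∈line⇒minor-equation : ∀ r a d v L t j m → Curve r a d v t ∈ᴸ L →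
    let e = Line.dir L; b = Line.base L in
    t ^ r * minor j v e m + t * minor j d e m + minor j (λ i → a i - b i) e m ≈ 0#
  curve∈line⇒minor-equation r a d v L t j m (s , on-L) = begin
    t ^ r * minor j v e m + t * minor j d e m + minor j (λ i → a i - b i) e m
      ≈⟨ solve 12 (λ T t′ aₘ aⱼ bₘ bⱼ dₘ dⱼ vₘ vⱼ eₘ eⱼ →
           T :* (vₘ :* eⱼ :- vⱼ :* eₘ) :+ t′ :* (dₘ :* eⱼ :- dⱼ :* eₘ) :+ ((aₘ :- bₘ) :* eⱼ :- (aⱼ :- bⱼ) :* eₘ)
           := ((aₘ :+ (t′ :* dₘ :+ T :* vₘ)) :- bₘ) :* eⱼ :- ((aⱼ :+ (t′ :* dⱼ :+ T :* vⱼ)) :- bⱼ) :* eₘ)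
         refl (t ^ r) t (a m) (a j) (b m) (b j) (d m) (d j) (v m) (v j) (e m) (e j) ⟩
    (X m - b m) * e j - (X j - b j) * e m
      ≈⟨ +-cong (*-congʳ (on-line m)) (-‿cong (*-congʳ (on-line j))) ⟩
    (s * e m) * e j - (s * e j) * e m
      ≈⟨ x≈y⇒x-y≈0 (solve 3 (λ s eₘ eⱼ → (s :* eₘ) :* eⱼ := (s :* eⱼ) :* eₘ) refl s (e m) (e j)) ⟩
    0# ∎
    where
    e = Line.dir L
    b = Line.base L
    X = Curve r a d v t
    on-line : ∀ i → X i - b i ≈ s * e i
    on-line i = trans (+-congʳ (on-L i)) (x+y-x≈y (b i) (s * e i))

  module _ (r : ℕ) (a d v : Point) (L : Line) where
    private
      R = ℕ.suc (ℕ.suc r)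
      e = Line.dir L
      w : Point
      w i = a i - Line.base L i
      OnL : Carrier → Set (c ⊔ ℓ)
      OnL t = Curve R a d v t ∈ᴸ L

      degree-R : ∀ j m → ¬ minor j v e m ≈ 0# → AtMost setoid R OnL
      degree-R j m Vₘ≉0 ts on-L = monic-roots-atMost (x^[2+r]+αx+β-monic r α β) ts λ i → begin
        ts i ^ R + α * ts i + β
          ≈⟨ +-congʳ (+-congʳ (trans (*-congˡ (*-inverseʳ (minor j v e m) Vₘ≉0)) (*-identityʳ _))) ⟨
        ts i ^ R * (minor j v e m * Vₘ⁻¹) + α * ts i + β
          ≈⟨ solve 6 (λ T t V D W V⁻¹ → T :* (V :* V⁻¹) :+ (D :* V⁻¹) :* t :+ W :* V⁻¹
                                       := V⁻¹ :* (T :* V :+ t :* D :+ W))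
               refl (ts i ^ R) (ts i) (minor j v e m) (minor j d e m) (minor j w e m) Vₘ⁻¹ ⟩
        Vₘ⁻¹ * (ts i ^ R * minor j v e m + ts i * minor j d e m + minor j w e m)
          ≈⟨ *-congˡ (curve∈line⇒minor-equation R a d v L (ts i) j m (on-L i)) ⟩
        Vₘ⁻¹ * 0#
          ≈⟨ zeroʳ Vₘ⁻¹ ⟩
        0# ∎
        where
        Vₘ⁻¹ = inverse (minor j v e m) Vₘ≉0
        α = minor j d e m * Vₘ⁻¹
        β = minor j w e m * Vₘ⁻¹

      degree-1 : ∀ j m → (∀ m → minor j v e m ≈ 0#) → ¬ minor j d e m ≈ 0# → AtMost setoid R OnL
      degree-1 j m V≈0 Dₘ≉0 ts on-L =
        zero , suc zero , (λ ()) , *-cancelˡ Dₘ≉0 (trans (linear zero) (sym (linear (suc zero))))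
        where
        linear : ∀ i → minor j d e m * ts i ≈ - minor j w e m
        linear i = x+y≈0⇒y≈-x (minor j w e m) _ (begin
          minor j w e m + minor j d e m * ts i  ≈⟨ solve 3 (λ W D t → W :+ D :* t := t :* D :+ W) refl _ _ (ts i) ⟩
          ts i * minor j d e m + minor j w e m  ≈⟨ +-congʳ (+-identityˡ _) ⟨
          0# + ts i * minor j d e m + minor j w e m
            ≈⟨ +-congʳ (+-congʳ (trans (*-congˡ (V≈0 m)) (zeroʳ _))) ⟨
          ts i ^ R * minor j v e m + ts i * minor j d e m + minor j w e m
            ≈⟨ curve∈line⇒minor-equation R a d v L (ts i) j m (on-L i) ⟩
          0# ∎)

    curve-meets-line : ¬ (d ∥ e × v ∥ e) → AtMost setoid R OnL
    curve-meets-line not-both with zero-or-nonzero-coordinate e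
    ... | inj₁ e≈0        = ⊥-elim (Line.dir≢0 L e≈0)
    ... | inj₂ (j , eⱼ≉0) with zero-or-nonzero-coordinate (minor j v e) | zero-or-nonzero-coordinate (minor j d e)
    ...   | inj₂ (m , Vₘ≉0) | _               = degree-R j m Vₘ≉0
    ...   | inj₁ V≈0        | inj₂ (m , Dₘ≉0) = degree-1 j m V≈0 Dₘ≉0
    ...   | inj₁ V≈0        | inj₁ D≈0        =
      ⊥-elim (not-both (minors-vanish⇒∥ eⱼ≉0 D≈0 , minors-vanish⇒∥ eⱼ≉0 V≈0))

module Construction {c ℓ} (F : CommutativeRing c ℓ) (r n K : ℕ) (p-prime : Prime (ℕ.suc (ℕ.suc r)))
                    (F-field : IsFieldOfOrder F (ℕ.suc (ℕ.suc r) ℕ.^ n)) where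
  p = ℕ.suc (ℕ.suc r)
  k = ℕ.suc (ℕ.suc K)
  open CommutativeRing F hiding (zero)
  open IsFieldOfOrder F-field using (1≉0)
  open FiniteField F F-field
  open AffineSpace F F-field k
  open Frobenius F p-prime using (frobenius-+)
  open IntegerSolver F using (solve; _:+_; _:*_; _:-_; _:=_)
  open import Algebra.Properties.CommutativeSemiring.Exp commutativeSemiring using (^-distrib-*)
  open import Relation.Binary.Reasoning.Setoid setoid

  frob : Carrier → Carrier
  frob x = x ^ p

  frob-+ : ∀ x y → frob (x + y) ≈ frob x + frob y
  frob-+ = frobenius-+ (q≡p^n⇒p·1≈0 n ≡.refl)

  frob-≈0 : ∀ {x} → frob x ≈ 0# → x ≈ 0#
  frob-≈0 = x^n≈0⇒x≈0 p

  frob-0 : frob 0# ≈ 0#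
  frob-0 = zeroˡ _

  u : ℕ → Carrier → Carrier
  u ℕ.zero    σ = 1#
  u (ℕ.suc i) σ = σ * frob (u i σ)

  u-cong : ∀ i {σ τ} → σ ≈ τ → u i σ ≈ u i τ
  u-cong ℕ.zero    σ≈τ = refl
  u-cong (ℕ.suc i) σ≈τ = *-cong σ≈τ (^-congˡ p (u-cong i σ≈τ))

  h : Carrier → Carrier
  h σ = (σ - 1#) * frob (u (ℕ.suc K) σ)

  h0≈0 : h 0# ≈ 0#
  h0≈0 = trans (*-congˡ (trans (^-congˡ p (zeroˡ _)) frob-0)) (zeroʳ _)

  h1≈0 : h 1# ≈ 0#
  h1≈0 = trans (*-congʳ (-‿inverseʳ 1#)) (zeroˡ _)

  γ-notInImage : ∃[ γ ] ∀ σ → ¬ h σ ≈ γ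
  γ-notInImage = nonInjective⇒missesValue h (λ σ≈τ → *-cong (+-congʳ σ≈τ) (^-congˡ p (u-cong (ℕ.suc K) σ≈τ)))
                   (λ 0≈1 → 1≉0 (sym 0≈1)) (trans h0≈0 (sym h1≈0))

  γ : Carrier
  γ = proj₁ γ-notInImage

  γ≉0 : ¬ γ ≈ 0#
  γ≉0 γ≈0 = proj₂ γ-notInImage 0# (trans h0≈0 (sym γ≈0))

  top : Fin k
  top = fromℕ (ℕ.suc K)

  T : Point → Point
  T d zero    = γ * frob (d top) + frob (d zero)
  T d (suc i) = frob (d (inject₁ i))

  T-cong : ∀ {x y} → x ≈ᵖ y → T x ≈ᵖ T y
  T-cong x≈y zero    = +-cong (*-congˡ (^-congˡ p (x≈y top))) (^-congˡ p (x≈y zero))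
  T-cong x≈y (suc i) = ^-congˡ p (x≈y (inject₁ i))

  T-+ : ∀ x y → T (λ m → x m + y m) ≈ᵖ (λ m → T x m + T y m)
  T-+ x y zero    = begin
    γ * frob (x top + y top) + frob (x zero + y zero)
      ≈⟨ +-cong (*-congˡ (frob-+ _ _)) (frob-+ _ _) ⟩
    γ * (frob (x top) + frob (y top)) + (frob (x zero) + frob (y zero))
      ≈⟨ solve 5 (λ g a b c d → g :* (a :+ b) :+ (c :+ d) := (g :* a :+ c) :+ (g :* b :+ d)) refl γ _ _ _ _ ⟩
    (γ * frob (x top) + frob (x zero)) + (γ * frob (y top) + frob (y zero)) ∎
  T-+ x y (suc i) = frob-+ _ _

  T-scale : ∀ t d → T (λ m → t * d m) ≈ᵖ (λ m → frob t * T d m)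
  T-scale t d zero    = begin
    γ * frob (t * d top) + frob (t * d zero)
      ≈⟨ +-cong (*-congˡ (^-distrib-* _ _ p)) (^-distrib-* _ _ p) ⟩
    γ * (frob t * frob (d top)) + frob t * frob (d zero)
      ≈⟨ solve 4 (λ g s a b → g :* (s :* a) :+ s :* b := s :* (g :* a :+ b)) refl γ (frob t) _ _ ⟩
    frob t * (γ * frob (d top) + frob (d zero)) ∎
  T-scale t d (suc i) = ^-distrib-* _ _ p

  module _ (d : Point) (s : Carrier) (eigen : ∀ m → T d m ≈ s * d m) (d₀≉0 : ¬ d zero ≈ 0#) where
    private
      d₀ = d zero
      w = d₀ ^ ℕ.suc r
      w≉0 : ¬ w ≈ 0#
      w≉0 w≈0 = d₀≉0 (x^n≈0⇒x≈0 (ℕ.suc r) w≈0)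
      σ = s * inverse w w≉0
      σw≈s : σ * w ≈ s
      σw≈s = trans (*-assoc _ _ _) (trans (*-congˡ (trans (*-comm _ _) (*-inverseʳ w w≉0))) (*-identityʳ s))

    -- The eigenvalue is σ d₀^(p-1), and then d₀ ≈ u i σ * d i along the cycle of T.
    eigenvector-scaling : ∀ m → d₀ ≈ u (toℕ m) σ * d m
    eigenvector-scaling = <-weakInduction (λ m → d₀ ≈ u (toℕ m) σ * d m) (sym (*-identityˡ d₀)) step
      where
      step : ∀ i → d₀ ≈ u (toℕ (inject₁ i)) σ * d (inject₁ i) → d₀ ≈ u (toℕ (suc i)) σ * d (suc i)
      step i d₀≈ = *-cancelˡ w≉0 (begin
        w * d₀                                 ≈⟨ *-comm w d₀ ⟩
        frob d₀
          ≈⟨ ^-congˡ p (trans d₀≈ (*-congʳ (reflexive (≡.cong (λ j → u j σ) (Fin.toℕ-inject₁ i))))) ⟩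
        frob (uᵢ * d (inject₁ i))              ≈⟨ ^-distrib-* uᵢ _ p ⟩
        frob uᵢ * frob (d (inject₁ i))         ≈⟨ *-congˡ (eigen (suc i)) ⟩
        frob uᵢ * (s * d (suc i))              ≈⟨ *-congˡ (*-congʳ σw≈s) ⟨
        frob uᵢ * ((σ * w) * d (suc i))
          ≈⟨ solve 4 (λ a σ w x → a :* ((σ :* w) :* x) := w :* ((σ :* a) :* x)) refl (frob uᵢ) σ w (d (suc i)) ⟩
        w * ((σ * frob uᵢ) * d (suc i))        ∎)
        where uᵢ = u (toℕ i) σ

    eigenvector⇒γ∈image : ∃[ σ ] h σ ≈ γ
    eigenvector⇒γ∈image = σ , *-cancelˡ (λ ≈0 → d-top≉0 (frob-≈0 ≈0)) (begin
      frob (d top) * ((σ - 1#) * frob uₖ)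
        ≈⟨ solve 4 (λ a σ one b → a :* ((σ :- one) :* b) := σ :* (b :* a) :- one :* (b :* a))
             refl (frob (d top)) σ 1# (frob uₖ) ⟩
      σ * (frob uₖ * frob (d top)) - 1# * (frob uₖ * frob (d top))
        ≈⟨ +-congˡ (-‿cong (*-identityˡ _)) ⟩
      σ * (frob uₖ * frob (d top)) - frob uₖ * frob (d top)
        ≈⟨ +-cong (*-congˡ frob-d₀) (-‿cong frob-d₀) ⟩
      σ * frob d₀ - frob d₀
        ≈⟨ +-congʳ σfrob-d₀ ⟩
      (γ * frob (d top) + frob d₀) - frob d₀
        ≈⟨ solve 2 (λ a b → a :+ b :- b := a) refl (γ * frob (d top)) (frob d₀) ⟩
      γ * frob (d top)
        ≈⟨ *-comm γ _ ⟩
      frob (d top) * γ ∎)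
      where
      uₖ = u (ℕ.suc K) σ
      d₀≈uₖd-top : d₀ ≈ uₖ * d top
      d₀≈uₖd-top = trans (eigenvector-scaling top) (reflexive (≡.cong (λ j → u j σ * d top) (Fin.toℕ-fromℕ (ℕ.suc K))))
      d-top≉0 : ¬ d top ≈ 0#
      d-top≉0 d-top≈0 = d₀≉0 (trans d₀≈uₖd-top (trans (*-congˡ d-top≈0) (zeroʳ uₖ)))
      frob-d₀ : frob uₖ * frob (d top) ≈ frob d₀
      frob-d₀ = trans (sym (^-distrib-* uₖ (d top) p)) (^-congˡ p (sym d₀≈uₖd-top))
      σfrob-d₀ : σ * frob d₀ ≈ γ * frob (d top) + frob d₀
      σfrob-d₀ = begin
        σ * (d₀ * w)   ≈⟨ solve 3 (λ σ a w → σ :* (a :* w) := (σ :* w) :* a) refl σ d₀ w ⟩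
        (σ * w) * d₀   ≈⟨ *-congʳ σw≈s ⟩
        s * d₀         ≈⟨ eigen zero ⟨
        T d zero       ∎

  T-eigenvector⇒0 : ∀ d s → (∀ m → T d m ≈ s * d m) → ∀ m → d m ≈ 0#
  T-eigenvector⇒0 d s eigen with d zero ≟ 0#
  ... | no d₀≉0  = ⊥-elim (let σ , hσ≈γ = eigenvector⇒γ∈image d s eigen d₀≉0 in proj₂ γ-notInImage σ hσ≈γ)
  ... | yes d₀≈0 = >-weakInduction (λ m → d m ≈ 0#) d-top≈0 step
    where
    d-top≈0 : d top ≈ 0#
    d-top≈0 = frob-≈0 (x*y≈0⇒y≈0 γ≉0 (begin
      γ * frob (d top)                   ≈⟨ +-identityʳ _ ⟨
      γ * frob (d top) + 0#              ≈⟨ +-congˡ (trans (^-congˡ p d₀≈0) frob-0) ⟨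
      γ * frob (d top) + frob (d zero)   ≈⟨ eigen zero ⟩
      s * d zero                         ≈⟨ *-congˡ d₀≈0 ⟩
      s * 0#                             ≈⟨ zeroʳ s ⟩
      0#                                 ∎))
    step : ∀ i → d (suc i) ≈ 0# → d (inject₁ i) ≈ 0#
    step i dᵢ₊₁≈0 = frob-≈0 (trans (eigen (suc i)) (trans (*-congˡ dᵢ₊₁≈0) (zeroʳ s)))

  ψ : Point → Point
  ψ x m = x m + T x m

  ψ-cong : ∀ {x y} → x ≈ᵖ y → ψ x ≈ᵖ ψ y
  ψ-cong x≈y m = +-cong (x≈y m) (T-cong x≈y m)

  -- ψ x ≈ ψ y makes x - y an eigenvector of T with eigenvalue -1.
  ψ-injective : ∀ {x y} → ψ x ≈ᵖ ψ y → x ≈ᵖ y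
  ψ-injective {x} {y} ψx≈ψy m = x-y≈0⇒x≈y (x m) (y m) (T-eigenvector⇒0 z (- 1#) eigen m)
    where
    z : Point
    z i = x i - y i
    Tx≈Tz+Ty : ∀ i → T x i ≈ T z i + T y i
    Tx≈Tz+Ty i = trans (T-cong (λ j → solve 2 (λ a b → a := (a :- b) :+ b) refl (x j) (y j)) i) (T-+ z y i)
    eigen : ∀ i → T z i ≈ - 1# * z i
    eigen i = begin
      T z i            ≈⟨ x+y≈0⇒y≈-x (z i) (T z i) (begin
        z i + T z i
          ≈⟨ solve 4 (λ a b c d → (a :- b) :+ c := ((a :+ (c :+ d)) :- (b :+ d))) refl (x i) (y i) (T z i) (T y i) ⟩
        (x i + (T z i + T y i)) - (y i + T y i) ≈⟨ +-congʳ (+-congˡ (Tx≈Tz+Ty i)) ⟨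
        ψ x i - ψ y i                           ≈⟨ x≈y⇒x-y≈0 (ψx≈ψy i) ⟩
        0#                                      ∎) ⟩
      - z i            ≈⟨ -1*x≈-x (z i) ⟨
      - 1# * z i       ∎
      where open import Algebra.Properties.Ring ring using (-1*x≈-x)

  ψ-line : ∀ a d t → ψ (λ m → a m + t * d m) ≈ᵖ Curve p (ψ a) d (T d) t
  ψ-line a d t m = begin
    (a m + t * d m) + T (λ j → a j + t * d j) m  ≈⟨ +-congˡ (T-+ a (λ j → t * d j) m) ⟩
    (a m + t * d m) + (T a m + T (λ j → t * d j) m) ≈⟨ +-congˡ (+-congˡ (T-scale t d m)) ⟩
    (a m + t * d m) + (T a m + frob t * T d m)
      ≈⟨ solve 5 (λ a td ta ft v → (a :+ td) :+ (ta :+ ft :* v) := (a :+ ta) :+ (td :+ ft :* v))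
           refl (a m) (t * d m) (T a m) (frob t) (T d m) ⟩
    (a m + T a m) + (t * d m + frob t * T d m)   ∎

  ψ-orthogoval : ∀ (L₁ L₂ : Line) → AtMost PointSetoid p (λ x → x ∈ᴸ L₁ × ψ x ∈ᴸ L₂)
  ψ-orthogoval L₁ L₂ xs on-both =
    let i , i′ , i≢i′ , tᵢ≈tᵢ′ = curve-meets-line r (ψ a) d (T d) L₂ d,Td∦e t on-curve
    in i , i′ , i≢i′ , λ m → trans (on-L₁ i m) (trans (+-congˡ (*-congʳ tᵢ≈tᵢ′)) (sym (on-L₁ i′ m)))
    where
    a = Line.base L₁
    d = Line.dir L₁
    t : Fin (ℕ.suc p) → Carrier
    t i = proj₁ (proj₁ (on-both i))
    on-L₁ : ∀ i m → xs i m ≈ a m + t i * d m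
    on-L₁ i = proj₂ (proj₁ (on-both i))
    on-curve : ∀ i → Curve p (ψ a) d (T d) (t i) ∈ᴸ L₂
    on-curve i = ∈ᴸ-resp-≈ᵖ L₂ (λ m → trans (ψ-cong (on-L₁ i) m) (ψ-line a d (t i) m)) (proj₂ (on-both i))
    d,Td∦e : ¬ (d ∥ Line.dir L₂ × T d ∥ Line.dir L₂)
    d,Td∦e (d∥e , Td∥e) =
      let s , Td≈sd = ∥-through Td∥e d∥e (Line.dir≢0 L₁)
      in Line.dir≢0 L₁ (T-eigenvector⇒0 d s Td≈sd)

  orthogovalPair : OrthogovalPair F k p
  orthogovalPair = record
    { P          = PointSetoid
    ; φ₁         = Identity.inverse PointSetoid
    ; φ₂         = injective⇒inverse ψ ψ-cong ψ-injective
    ; orthogoval = ψ-orthogoval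
    }
    where open FiniteSetoid PointSetoid Point-enumeration using (injective⇒inverse)

open import Data.Nat using (_^_; _≤_)

mainTheorem2 : ∀ {c ℓ} (p n k : ℕ) → Prime p → 1 ≤ n → 2 ≤ k →
    (F : CommutativeRing c ℓ) → IsFieldOfOrder F (p ^ n) →
    OrthogovalPair F k p
mainTheorem2 0             _ _ ()
mainTheorem2 1             _ _ ()
mainTheorem2 (suc (suc r)) n zero       _ _ ()
mainTheorem2 (suc (suc r)) n (suc zero) _ _ (s≤s ())
mainTheorem2 (suc (suc r)) n (suc (suc K)) p-prime _ _ F F-field = Construction.orthogovalPair F r n K p-prime F-field
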